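{- Let $d\ge2$ and $p_1,\dots,p_d\in\mathbb{TP}^d$ be arbitrary points (not necessarily in general position). Then the set $\{x\in\mathbb{TP}^d:\tau_{p_1,\dots,p_d}(x)=1\}$ is either empty or the union of at most $d$ open sectors of a single tropical hyperplane. Conversely, for every tropical hyperplane $\mathcal H$ and every union $U$ of at least one and at most $d$ open sectors of $\mathcal H$, there exist points $p_1,\dots,p_d\in\mathbb{TP}^d$ with $\{x\in\mathbb{TP}^d:\tau_{p_1,\dots,p_d}(x)=1\}=U$.
   Context: $\mathbb{TP}^d=\mathbb R^{d+1}/\mathbb R(1,\dots,1)$, points written via representatives $(\xi_0,\dots,\xi_d)$. For $c=(\gamma_0,\dots,\gamma_d)\in\mathbb{TP}^d$, the tropical hyperplane with apex $c$ is the set of $x$ such that $\min_i(\xi_i-\gamma_i)$ is attained at least twice; its open sectors are the $d+1$ sets $c+S_k$, $k=0,\dots,d$, where $S_k=\{(\xi_0,\dots,\xi_d):\xi_k<\xi_j\text{ for all }j\ne k\}$. For a real matrix $M=(m_{ij})_{i,j=0}^d$ the tropical determinant is $\mathrm{tdet}\,M=\min_{\sigma\in\mathrm{Sym}(d+1)}(m_{0,\sigma(0)}+\dots+m_{d,\sigma(d)})$; $M$ is tropically singular if this minimum is attained by at least two permutations, otherwise tropically regular. The tropical sign $\mathrm{tsgn}\,M$ is $0$ if $M$ is tropically singular, and otherwise the sign of the unique minimizing permutation. Adding a constant to a row does not change $\mathrm{tsgn}$, so for $x,p_1,\dots,p_d\in\mathbb{TP}^d$ the value $\tau_{p_1,\dots,p_d}(x)=\mathrm{tsgn}(x,p_1,\dots,p_d)\in\{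 -1,0,1\}$ (matrix with rows representatives of $x,p_1,\dots,p_d$, in this order) is well defined. -}

module Defs where

open import Level using (0ℓ)
open import Data.Nat as ℕ using (ℕ; zero; suc)
open import Data.Fin as Fin using (Fin; zero; suc)
open import Data.Fin.Subset using (Subset; _∈_)
open import Data.List using (List; []; _∷_; map; concatMap; allFin)
open import Data.Nat.ListAction using (sum)
open import Data.Bool using (Bool; true; false; if_then_else_; _∧_)
open import Relation.Nullary.Decidable using (⌊_⌋)
open import Data.Product using (Σ; ∃; ∃-syntax; _×_; _,_)
open import Data.Sum using (_⊎_)
open import Relation.Nullary using (¬_)
open import Relation.Binary.PropositionalEquality using (_≡_; _≢_)
open import Relation.Binary.Structures using (IsStrictTotalOrder)
open import Algebra.Structures using (IsCommutativeRing)
open import Function.Definitions using (Injective)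

-- The real numbers, axiomatised as a complete ordered field.
-- (agda-stdlib has no reals; any model of this record is isomorphic to ℝ.)

record Reals : Set₁ where
  infixl 6 _+_
  infixl 7 _*_
  infix 4 _<_ _≤_
  field
    ℝ   : Set
    _+_ : ℝ → ℝ → ℝ
    _*_ : ℝ → ℝ → ℝ
    -_  : ℝ → ℝ
    0#  : ℝ
    1#  : ℝ
    _<_ : ℝ → ℝ → Set
    isCommutativeRing   : IsCommutativeRing _≡_ _+_ _*_ -_ 0# 1#
    <-isStrictTotalOrder : IsStrictTotalOrder _≡_ _<_
    0<1      : 0# < 1#
    +-mono-< : ∀ {x y} z → x < y → x + z < y + z
    *-pos    : ∀ {x y} → 0# < x → 0# < y → 0# < x * y
    inverse  : ∀ x → x ≢ 0# → ∃[ y ] (x * y ≡ 1#)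

  _≤_ : ℝ → ℝ → Set
  x ≤ y = x < y ⊎ x ≡ y

  field
    sup : (P : ℝ → Set) → (∃[ x ] P x) → (∃[ b ] (∀ x → P x → x ≤ b)) →
          ∃[ s ] ((∀ x → P x → x ≤ s) × (∀ b → (∀ x → P x → x ≤ b) → s ≤ b))

Perm : ℕ → Set
Perm n = Σ (Fin n → Fin n) Injective′
  where Injective′ : (Fin n → Fin n) → Set
        Injective′ f = Injective _≡_ _≡_ f

perm : ∀ {n} → Perm n → Fin n → Fin n
perm (f , _) = f

data Sign : Set where
  minus zero plus : Sign

inversions : ∀ {n} → Perm n → ℕ
inversions {n} σ = sum (concatMap (λ i → map (inv i) (allFin n)) (allFin n))
  where
  inv : Fin n → Fin n → ℕ
  inv i j = if ⌊ i Fin.<? j ⌋ ∧ ⌊ perm σ j Fin.<? perm σ i ⌋ then 1 else 0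

even : ℕ → Bool
even zero          = true
even (suc zero)    = false
even (suc (suc n)) = even n

sgn : ∀ {n} → Perm n → Sign
sgn σ = if even (inversions σ) then plus else minus

module Tropical (R : Reals) where
  open Reals R

  sumFin : ∀ n → (Fin n → ℝ) → ℝ
  sumFin zero    f = 0#
  sumFin (suc n) f = f zero + sumFin n (λ i → f (suc i))

  -- a (representative of a) point of TP^d : a vector in ℝ^(d+1)
  Point : ℕ → Set
  Point d = Fin (suc d) → ℝ

  Matrix : ℕ → Set
  Matrix n = Fin n → Fin n → ℝ

  weight : ∀ {n} → Matrix n → Perm n → ℝ
  weight {n} M σ = sumFin n (λ i → M i (perm σ i))

  Minimizer : ∀ {n} → Matrix n → Perm n → Set
  Minimizer M σ = ∀ τ → weight M σ ≤ weight M τ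

  DistinctPerm : ∀ {n} → Perm n → Perm n → Set
  DistinctPerm σ τ = ¬ (∀ i → perm σ i ≡ perm τ i)

  TropSingular : ∀ {n} → Matrix n → Set
  TropSingular M = ∃[ σ ] ∃[ τ ] (Minimizer M σ × Minimizer M τ × DistinctPerm σ τ)

  data HasTSgn {n} (M : Matrix n) : Sign → Set where
    singular : TropSingular M → HasTSgn M zero
    regular  : (σ : Perm n) → Minimizer M σ →
               (∀ τ → Minimizer M τ → ¬ DistinctPerm σ τ) →
               HasTSgn M (sgn σ)

  rowsMatrix : ∀ {d} → Point d → (Fin d → Point d) → Matrix (suc d)
  rowsMatrix x p zero    = x
  rowsMatrix x p (suc k) = p k

  TauOne : ∀ {d} → (Fin d → Point d) → Point d → Set
  TauOne p x = HasTSgn (rowsMatrix x p) plus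

  _-ℝ_ : ℝ → ℝ → ℝ
  a -ℝ b = a + (- b)

  -- x ∈ c + S_k, the k-th open sector of the tropical hyperplane with apex c
  InSector : ∀ {d} → Point d → Fin (suc d) → Point d → Set
  InSector c k x = ∀ j → j ≢ k → (x k -ℝ c k) < (x j -ℝ c j)

  InUnion : ∀ {d} → Point d → Subset (suc d) → Point d → Set
  InUnion c K x = ∃[ k ] (k ∈ K × InSector c k x)

-- Expanding tdet(x, p₁, …, p_d) along the row of x, the unique minimizing permutation
-- (when there is one) matches x to the column k minimizing x_k + tdet P_k, where P_k
-- is the d × d minor of the p's without column k; so τ(x) = 1 iff this minimum is strict
-- and P_k has a unique minimizer whose extension by (x ↦ k) is even. The positive set is
-- thus the union of the sectors with these k of the hyperplane with apex (−tdet P_k)_k,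
-- and not every k qualifies: with p₁ repeated as the row x, the two equal rows can be
-- exchanged without changing the weight, so minimizers of both parities would exist.
-- Conversely, if the zero entries of a 0/1 matrix form a spanning tree on the columns
-- (one row per edge), every P_k has a unique zero-weight matching, and the signs
-- alternate along the edges. Attaching leaves one at a time realizes every non-constant
-- sign pattern up to a global sign, swapping two rows (possible as d ≥ 2) flips that
-- sign, and translating the columns by the apex moves the hyperplane into place.

module Submission where

open import Defs
open import Data.Nat using (ℕ; suc; _≤_)
open import Data.Fin using (Fin)
open import Data.Fin.Subset using (Subset; ∣_∣)
open import Data.Product using (_×_; ∃-syntax)
open import Data.Sum using (_⊎_)
open import Relation.Nullary using (¬_)
open import Function.Bundles using (_⇔_)

import Algebra.Properties.CommutativeMonoid.Sum
open import Algebra.Bundles using (CommutativeMonoid; AbelianGroup)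
open import Algebra.Structures using (IsCommutativeRing)
open import Data.Bool as Bool using (Bool; true; false; not; _∧_; if_then_else_; T; T?)
open import Data.Bool.Properties using (not-involutive; ¬-not; T-≡)
open import Data.Empty using (⊥-elim)
open import Data.Fin as Fin using (zero; suc; toℕ; punchIn; punchOut)
open import Data.Fin.Properties
  using (suc-injective; punchInᵢ≢i; punchIn-injective; punchOut-injective; punchIn-punchOut; any?; all?; ¬∀⟶∃¬)
open import Data.Fin.Subset using (_∈_; _∉_; ⊤)
open import Data.Fin.Subset.Properties
  using (_∈?_; ∈⊤; ⊆⊤; ∣⊤∣≡n; ∣⊥∣≡0; p⊂q⇒∣p∣<∣q∣; p⊆q⇒∣p∣≤∣q∣; nonempty?; Empty-unique)
open import Data.List as List using (List; map; concatMap; tabulate)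
open import Data.List.Properties using (map-tabulate)
open import Data.Nat as ℕ using (zero; s≤s)
import Data.Nat.ListAction as ListAction
open import Data.Nat.ListAction.Properties using (sum-++)
import Data.Nat.Properties as ℕ
open import Data.Product using (∃; _,_; proj₁; proj₂)
open import Data.Sum as Sum using (inj₁; inj₂)
import Data.Vec as Vec
open import Data.Vec.Functional using (_∷_; removeAt)
open import Data.Vec.Properties using ([]=⇒lookup; lookup⇒[]=; lookup∘tabulate)
open import Function using (_∘_; id)
open import Function.Bundles using (mk⇔; Equivalence)
open import Function.Definitions using (Injective)
open import Relation.Binary.Bundles using (StrictPartialOrder)
open import Relation.Binary.Definitions using (tri<; tri≈; tri>)
open import Relation.Binary.PropositionalEquality
  using (_≡_; _≢_; refl; sym; trans; cong; cong₂; subst; subst₂; _≗_; isEquivalence; module ≡-Reasoning)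
open import Relation.Binary.Structures using (IsStrictTotalOrder)
open import Relation.Nullary using (Dec; yes; no; contradiction; ¬?; _×-dec_)
open import Relation.Nullary.Decidable using (⌊_⌋; isYes≗does; toWitness; fromWitness; decidable-stable)

private
  variable
    n : ℕ

-- Permutations

_≈ₚ_ : Perm n → Perm n → Set
σ ≈ₚ τ = perm σ ≗ perm τ

id₀ : Perm 0
id₀ = (λ ()) , λ {}

insert : Fin (suc n) → Perm n → Perm (suc n)
insert k ρ = k ∷ punchIn k ∘ perm ρ , injective
  where
  injective : Injective _≡_ _≡_ (k ∷ punchIn k ∘ perm ρ)
  injective {zero}  {zero}  _ = refl
  injective {zero}  {suc j} e = contradiction (sym e) (punchInᵢ≢i k (perm ρ j))
  injective {suc i} {zero}  e = contradiction e (punchInᵢ≢i k (perm ρ i))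
  injective {suc i} {suc j} e = cong suc (proj₂ ρ (punchIn-injective k _ _ e))

head≢tail : (σ : Perm (suc n)) (i : Fin n) → perm σ zero ≢ perm σ (suc i)
head≢tail σ i e with proj₂ σ e
... | ()

remove : Perm (suc n) → Perm n
remove σ = (λ i → punchOut (head≢tail σ i)) ,
           λ e → suc-injective (proj₂ σ (punchOut-injective (head≢tail σ _) (head≢tail σ _) e))

insert-cong : ∀ k {ρ ρ′ : Perm n} → ρ ≈ₚ ρ′ → insert k ρ ≈ₚ insert k ρ′
insert-cong k e zero    = refl
insert-cong k e (suc i) = cong (punchIn k) (e i)

insert-remove : (σ : Perm (suc n)) → insert (perm σ zero) (remove σ) ≈ₚ σ
insert-remove σ zero    = refl
insert-remove σ (suc i) = punchIn-punchOut (head≢tail σ i)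

remove-≈ₚ : ∀ {σ : Perm (suc n)} {k ρ} → σ ≈ₚ insert k ρ → remove σ ≈ₚ ρ
remove-≈ₚ {σ = σ} {k} {ρ} e i = punchIn-injective k _ _ (begin
  punchIn k (perm (remove σ) i)               ≡⟨ cong (λ a → punchIn a (perm (remove σ) i)) (sym (e zero)) ⟩
  punchIn (perm σ zero) (perm (remove σ) i)   ≡⟨ insert-remove σ (suc i) ⟩
  perm σ (suc i)                              ≡⟨ e (suc i) ⟩
  punchIn k (perm ρ i)                        ∎)
  where open ≡-Reasoning

insert-≈ₚ : ∀ {τ : Perm (suc n)} {t ρ} → perm τ zero ≡ t → ρ ≈ₚ remove τ → insert t ρ ≈ₚ τ
insert-≈ₚ τ₀≡t ρ≈ zero    = sym τ₀≡t
insert-≈ₚ {τ = τ} {t} {ρ} τ₀≡t ρ≈ (suc i) = begin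
  punchIn t (perm ρ i)                        ≡⟨ cong (punchIn t) (ρ≈ i) ⟩
  punchIn t (perm (remove τ) i)               ≡⟨ cong (λ a → punchIn a (perm (remove τ) i)) τ₀≡t ⟨
  punchIn (perm τ zero) (perm (remove τ) i)   ≡⟨ insert-remove τ (suc i) ⟩
  perm τ (suc i)                              ∎
  where open ≡-Reasoning

transpose₀₁ : Fin (suc (suc n)) → Fin (suc (suc n))
transpose₀₁ = suc zero ∷ zero ∷ λ i → suc (suc i)

transpose₀₁-involutive : ∀ (i : Fin (suc (suc n))) → transpose₀₁ (transpose₀₁ i) ≡ i
transpose₀₁-involutive zero          = refl
transpose₀₁-involutive (suc zero)    = refl
transpose₀₁-involutive (suc (suc i)) = refl

swap : Perm (suc (suc n)) → Perm (suc (suc n))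
swap σ = perm σ ∘ transpose₀₁ , λ {i} {j} e →
  trans (sym (transpose₀₁-involutive i))
        (trans (cong transpose₀₁ (proj₂ σ e)) (transpose₀₁-involutive j))

perm-surjective : (σ : Perm n) → ∀ y → ∃ λ i → perm σ i ≡ y
perm-surjective {suc n} σ y with perm σ zero Fin.≟ y
... | yes e = zero , e
... | no ne with perm-surjective (remove σ) (punchOut ne)
...   | i , e = suc i , (begin
  perm σ (suc i)                              ≡⟨ insert-remove σ (suc i) ⟨
  punchIn (perm σ zero) (perm (remove σ) i)   ≡⟨ cong (punchIn (perm σ zero)) e ⟩
  punchIn (perm σ zero) (punchOut ne)         ≡⟨ punchIn-punchOut ne ⟩
  y                                           ∎)
  where open ≡-Reasoning

any-perm? : {P : Perm n → Set} → (∀ {σ τ} → σ ≈ₚ τ → P σ → P τ) →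
            (∀ σ → Dec (P σ)) → Dec (∃ P)
any-perm? {zero} resp P? with P? id₀
... | yes p = yes (id₀ , p)
... | no ¬p = no λ (σ , p) → ¬p (resp (λ ()) p)
any-perm? {suc n} {P} resp P?
  with any? (λ k → any-perm? (λ {ρ} {ρ′} e → resp (insert-cong k {ρ} {ρ′} e)) (λ ρ → P? (insert k ρ)))
... | yes (k , ρ , p) = yes (insert k ρ , p)
... | no ¬p = no λ (σ , p) → ¬p (perm σ zero , remove σ , resp (λ i → sym (insert-remove σ i)) p)

module _ {c ℓ} (M : CommutativeMonoid c ℓ) where
  open CommutativeMonoid M using (Carrier; _≈_; _∙_; ∙-congˡ; setoid) renaming (refl to ≈-refl)
  open import Algebra.Properties.CommutativeMonoid.Sum M
  open import Relation.Binary.Reasoning.Setoid setoid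

  sum-∘perm : (σ : Perm n) (g : Fin n → Carrier) → sum (g ∘ perm σ) ≈ sum g
  sum-∘perm {zero}  σ g = ≈-refl
  sum-∘perm {suc n} σ g = begin
    g σ₀ ∙ sum (g ∘ perm σ ∘ suc)                   ≡⟨ cong (g σ₀ ∙_) (sum-cong-≗ (λ i → cong g (insert-remove σ (suc i)))) ⟨
    g σ₀ ∙ sum (removeAt g σ₀ ∘ perm (remove σ))    ≈⟨ ∙-congˡ (sum-∘perm (remove σ) (removeAt g σ₀)) ⟩
    g σ₀ ∙ sum (removeAt g σ₀)                      ≈⟨ sum-remove g ⟨
    sum g                                           ∎
    where σ₀ = perm σ zero

-- Inversions and parity

open import Algebra.Properties.CommutativeMonoid.Sum ℕ.+-0-commutativeMonoid
  using (sum; sum-syntax; sum-cong-≗; sum-replicate-zero)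
import Algebra.Properties.CommutativeSemigroup ℕ.+-commutativeSemigroup as ℕ-+

indicator : Bool → ℕ
indicator b = if b then 1 else 0

_<ᶠ_ : ∀ {m m′} → Fin m → Fin m′ → Bool
i <ᶠ j = toℕ i ℕ.<ᵇ toℕ j

-- Only the pairs (0, suc j) count in the row i = 0, so inversionCount f unfolds
-- definitionally to ∑[ j < n ] indicator (f (suc j) <ᶠ f zero) + inversionCount (f ∘ suc).
inversionCount : ∀ {m} → (Fin n → Fin m) → ℕ
inversionCount {n} f = ∑[ i < n ] ∑[ j < n ] indicator (i <ᶠ j ∧ f j <ᶠ f i)

sum-tabulate : (f : Fin n → ℕ) → ListAction.sum (tabulate f) ≡ sum f
sum-tabulate {zero}  f = refl
sum-tabulate {suc n} f = cong (f zero ℕ.+_) (sum-tabulate (f ∘ suc))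

sum-concatMap-tabulate : ∀ {A : Set} (g : A → List ℕ) (f : Fin n → A) →
                         ListAction.sum (concatMap g (tabulate f)) ≡ sum (ListAction.sum ∘ g ∘ f)
sum-concatMap-tabulate {zero}  g f = refl
sum-concatMap-tabulate {suc n} g f =
  trans (sum-++ (g (f zero)) _) (cong (ListAction.sum (g (f zero)) ℕ.+_) (sum-concatMap-tabulate g (f ∘ suc)))

inversions≡inversionCount : (σ : Perm n) → inversions σ ≡ inversionCount (perm σ)
inversions≡inversionCount {n} σ = trans (sum-concatMap-tabulate row id) (sum-cong-≗ row-sum)
  where
  inv : Fin n → Fin n → ℕ
  inv i j = if ⌊ i Fin.<? j ⌋ ∧ ⌊ perm σ j Fin.<? perm σ i ⌋ then 1 else 0
  row : Fin n → List ℕ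
  row i = map (inv i) (List.allFin n)
  row-sum : ∀ i → ListAction.sum (row i) ≡ ∑[ j < n ] indicator (i <ᶠ j ∧ perm σ j <ᶠ perm σ i)
  row-sum i = trans (cong ListAction.sum (map-tabulate id (inv i))) (trans (sum-tabulate (inv i))
    (sum-cong-≗ λ j → cong₂ (λ a b → indicator (a ∧ b)) (isYes≗does (i Fin.<? j)) (isYes≗does (perm σ j Fin.<? perm σ i))))

inversionCount-cong : ∀ {m} {f g : Fin n → Fin m} → f ≗ g → inversionCount f ≡ inversionCount g
inversionCount-cong e = sum-cong-≗ λ i → sum-cong-≗ λ j →
  cong₂ (λ a b → indicator (i <ᶠ j ∧ a <ᶠ b)) (e j) (e i)

punchIn-<ᶠ : ∀ {m} (k : Fin (suc m)) (a b : Fin m) → punchIn k a <ᶠ punchIn k b ≡ a <ᶠ b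
punchIn-<ᶠ zero    a       b       = refl
punchIn-<ᶠ (suc k) zero    zero    = refl
punchIn-<ᶠ (suc k) zero    (suc b) = refl
punchIn-<ᶠ (suc k) (suc a) zero    = refl
punchIn-<ᶠ (suc k) (suc a) (suc b) = punchIn-<ᶠ k a b

punchIn-<ᶠ-self : ∀ {m} (k : Fin (suc m)) (a : Fin m) → punchIn k a <ᶠ k ≡ a <ᶠ k
punchIn-<ᶠ-self zero    a       = refl
punchIn-<ᶠ-self (suc k) zero    = refl
punchIn-<ᶠ-self (suc k) (suc a) = punchIn-<ᶠ-self k a

inversionCount-punchIn : ∀ {m} (k : Fin (suc m)) (f : Fin n → Fin m) →
                         inversionCount (punchIn k ∘ f) ≡ inversionCount f
inversionCount-punchIn k f = sum-cong-≗ λ i → sum-cong-≗ λ j →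
  cong (λ b → indicator (i <ᶠ j ∧ b)) (punchIn-<ᶠ k (f j) (f i))

count-<ᶠ : ∀ (k : Fin (suc n)) → ∑[ a < n ] indicator (a <ᶠ k) ≡ toℕ k
count-<ᶠ {n}     zero    = sum-replicate-zero n
count-<ᶠ {suc n} (suc k) = cong suc (count-<ᶠ k)

inversionCount-insert : ∀ k (ρ : Perm n) →
                        inversionCount (perm (insert k ρ)) ≡ toℕ k ℕ.+ inversionCount (perm ρ)
inversionCount-insert {n} k ρ = cong₂ ℕ._+_ below (inversionCount-punchIn k (perm ρ))
  where
  below : ∑[ j < n ] indicator (punchIn k (perm ρ j) <ᶠ k) ≡ toℕ k
  below = trans (sum-cong-≗ (λ j → cong indicator (punchIn-<ᶠ-self k (perm ρ j))))
                (trans (sum-∘perm ℕ.+-0-commutativeMonoid ρ (λ a → indicator (a <ᶠ k))) (count-<ᶠ k))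

<ᶠ-flip : ∀ {m} {a b : Fin m} → a ≢ b → a <ᶠ b ≡ not (b <ᶠ a)
<ᶠ-flip {a = zero}  {zero}  ne = contradiction refl ne
<ᶠ-flip {a = zero}  {suc b} ne = refl
<ᶠ-flip {a = suc a} {zero}  ne = refl
<ᶠ-flip {a = suc a} {suc b} ne = <ᶠ-flip (ne ∘ cong suc)

even-suc : ∀ m → even (suc m) ≡ not (even m)
even-suc zero          = refl
even-suc (suc zero)    = refl
even-suc (suc (suc m)) = even-suc m

even-indicator-not : ∀ b m → even (indicator (not b) ℕ.+ m) ≡ not (even (indicator b ℕ.+ m))
even-indicator-not true  m = sym (trans (cong not (even-suc m)) (not-involutive (even m)))
even-indicator-not false m = even-suc m

even-+-not : ∀ m {a b} → even a ≡ not (even b) → even (m ℕ.+ a) ≡ not (even (m ℕ.+ b))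
even-+-not zero    e = e
even-+-not (suc m) {a} {b} e = begin
  even (suc (m ℕ.+ a))        ≡⟨ even-suc (m ℕ.+ a) ⟩
  not (even (m ℕ.+ a))        ≡⟨ cong not (even-+-not m e) ⟩
  not (not (even (m ℕ.+ b)))  ≡⟨ cong not (even-suc (m ℕ.+ b)) ⟨
  not (even (suc (m ℕ.+ b)))  ∎
  where open ≡-Reasoning

inversionCount-swap : ∀ {m} (f : Fin (suc (suc n)) → Fin m) → f zero ≢ f (suc zero) →
                      even (inversionCount (f ∘ transpose₀₁)) ≡ not (even (inversionCount f))
inversionCount-swap {n} f ne = begin
  even (inversionCount (f ∘ transpose₀₁))       ≡⟨ cong even swapped ⟩
  even (indicator (f zero <ᶠ f one) ℕ.+ X)      ≡⟨ cong (λ b → even (indicator b ℕ.+ X)) (<ᶠ-flip ne) ⟩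
  even (indicator (not (f one <ᶠ f zero)) ℕ.+ X) ≡⟨ even-indicator-not (f one <ᶠ f zero) X ⟩
  not (even (indicator (f one <ᶠ f zero) ℕ.+ X)) ≡⟨ cong (not ∘ even) original ⟨
  not (even (inversionCount f))                 ∎
  where
  open ≡-Reasoning
  one : Fin (suc (suc n))
  one = suc zero
  A B R X : ℕ
  A = ∑[ j < n ] indicator (f (suc (suc j)) <ᶠ f zero)
  B = ∑[ j < n ] indicator (f (suc (suc j)) <ᶠ f one)
  R = inversionCount (λ j → f (suc (suc j)))
  X = A ℕ.+ (B ℕ.+ R)
  original : inversionCount f ≡ indicator (f one <ᶠ f zero) ℕ.+ X
  original = ℕ.+-assoc (indicator (f one <ᶠ f zero)) A (B ℕ.+ R)
  swapped : inversionCount (f ∘ transpose₀₁) ≡ indicator (f zero <ᶠ f one) ℕ.+ X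
  swapped = trans (ℕ.+-assoc (indicator (f zero <ᶠ f one)) B (A ℕ.+ R))
                  (cong (indicator (f zero <ᶠ f one) ℕ.+_) (ℕ-+.x∙yz≈y∙xz B A R))

parity : Perm n → Bool
parity σ = even (inversions σ)

parity-inversionCount : (σ : Perm n) → parity σ ≡ even (inversionCount (perm σ))
parity-inversionCount σ = cong even (inversions≡inversionCount σ)

parity-cong : {σ τ : Perm n} → σ ≈ₚ τ → parity σ ≡ parity τ
parity-cong {σ = σ} {τ} e = trans (parity-inversionCount σ)
  (trans (cong even (inversionCount-cong e)) (sym (parity-inversionCount τ)))

parity-insert : ∀ k (ρ : Perm n) → parity (insert k ρ) ≡ even (toℕ k ℕ.+ inversionCount (perm ρ))
parity-insert k ρ = trans (parity-inversionCount (insert k ρ)) (cong even (inversionCount-insert k ρ))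

parity-insert-zero : (ρ : Perm n) → parity (insert zero ρ) ≡ parity ρ
parity-insert-zero ρ = trans (parity-insert zero ρ) (sym (parity-inversionCount ρ))

parity-swap : (σ : Perm (suc (suc n))) → parity (swap σ) ≡ not (parity σ)
parity-swap σ = begin
  parity (swap σ)                         ≡⟨ parity-inversionCount (swap σ) ⟩
  even (inversionCount (perm σ ∘ transpose₀₁)) ≡⟨ inversionCount-swap (perm σ) (head≢tail σ zero) ⟩
  not (even (inversionCount (perm σ)))    ≡⟨ cong not (parity-inversionCount σ) ⟨
  not (parity σ)                          ∎
  where open ≡-Reasoning

parity-insert-suc-insert-zero : ∀ k (ρ : Perm n) →
  parity (insert (suc k) (insert zero ρ)) ≡ not (parity (insert k ρ))
parity-insert-suc-insert-zero k ρ = begin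
  parity (insert (suc k) (insert zero ρ))          ≡⟨ parity-insert (suc k) (insert zero ρ) ⟩
  even (suc (toℕ k ℕ.+ inversionCount (perm (insert zero ρ))))
                                                   ≡⟨ cong (λ m → even (suc (toℕ k ℕ.+ m))) (inversionCount-insert zero ρ) ⟩
  even (suc (toℕ k ℕ.+ inversionCount (perm ρ)))   ≡⟨ even-suc (toℕ k ℕ.+ inversionCount (perm ρ)) ⟩
  not (even (toℕ k ℕ.+ inversionCount (perm ρ)))   ≡⟨ cong not (parity-insert k ρ) ⟨
  not (parity (insert k ρ))                        ∎
  where open ≡-Reasoning

parity-insert-suc-suc-insert-one : ∀ k (ρ : Perm (suc n)) →
  parity (insert (suc (suc k)) (insert (suc zero) ρ)) ≡ parity (insert (suc k) ρ)
parity-insert-suc-suc-insert-one k ρ = begin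
  parity (insert (suc (suc k)) (insert (suc zero) ρ))
      ≡⟨ parity-insert (suc (suc k)) (insert (suc zero) ρ) ⟩
  even (toℕ k ℕ.+ inversionCount (perm (insert (suc zero) ρ)))
      ≡⟨ cong (λ m → even (toℕ k ℕ.+ m)) (inversionCount-insert (suc zero) ρ) ⟩
  even (toℕ k ℕ.+ suc (inversionCount (perm ρ)))
      ≡⟨ cong even (ℕ.+-suc (toℕ k) _) ⟩
  even (suc (toℕ k) ℕ.+ inversionCount (perm ρ))
      ≡⟨ parity-insert (suc k) ρ ⟨
  parity (insert (suc k) ρ) ∎
  where open ≡-Reasoning

parity-insert-swap : ∀ k (ρ : Perm (suc (suc n))) → parity (insert k (swap ρ)) ≡ not (parity (insert k ρ))
parity-insert-swap k ρ = begin
  parity (insert k (swap ρ))                                ≡⟨ parity-insert k (swap ρ) ⟩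
  even (toℕ k ℕ.+ inversionCount (perm ρ ∘ transpose₀₁))   ≡⟨ even-+-not (toℕ k) (inversionCount-swap (perm ρ) (head≢tail ρ zero)) ⟩
  not (even (toℕ k ℕ.+ inversionCount (perm ρ)))           ≡⟨ cong not (parity-insert k ρ) ⟨
  not (parity (insert k ρ))                                 ∎
  where open ≡-Reasoning

minor : ∀ {A : Set} → (Fin (suc n) → Fin (suc n) → A) → Fin (suc n) → Fin n → Fin n → A
minor M k i = removeAt (M (suc i)) k

deleteColumn : ∀ {A : Set} → (Fin n → Fin (suc n) → A) → Fin (suc n) → Fin n → Fin n → A
deleteColumn P k i = removeAt (P i) k

Matching : (Fin n → Fin n → Bool) → Perm n → Set
Matching Z σ = ∀ i → T (Z i (perm σ i))

UniqueMatching : (Fin n → Fin n → Bool) → Perm n → Set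
UniqueMatching Z σ = Matching Z σ × (∀ τ → Matching Z τ → σ ≈ₚ τ)

module _ {Z : Fin (suc n) → Fin (suc n) → Bool} where

  matching-insert : ∀ {k ρ} → T (Z zero k) → Matching (minor Z k) ρ → Matching Z (insert k ρ)
  matching-insert z m zero    = z
  matching-insert z m (suc i) = m i

  matching-remove : ∀ {σ} → Matching Z σ → Matching (minor Z (perm σ zero)) (remove σ)
  matching-remove {σ} m i = subst (T ∘ Z (suc i)) (sym (insert-remove σ (suc i))) (m (suc i))

  uniqueMatching-insert : ∀ {t ρ} → T (Z zero t) → (∀ τ → Matching Z τ → perm τ zero ≡ t) →
                          UniqueMatching (minor Z t) ρ → UniqueMatching Z (insert t ρ)
  uniqueMatching-insert {t} {ρ} z forced (m , unique) = matching-insert {t} {ρ} z m , agrees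
    where
    agrees : ∀ τ → Matching Z τ → insert t ρ ≈ₚ τ
    agrees τ mτ = insert-≈ₚ {τ = τ} {t} {ρ} (forced τ mτ) (unique (remove τ)
      (subst (λ a → Matching (minor Z a) (remove τ)) (forced τ mτ) (matching-remove {τ} mτ)))

  forced-by-row : ∀ {t} → (∀ j → T (Z zero j) → j ≡ t) → ∀ τ → Matching Z τ → perm τ zero ≡ t
  forced-by-row only τ m = only (perm τ zero) (m zero)

  forced-by-column : ∀ {t} → (∀ i → ¬ T (Z (suc i) t)) → ∀ τ → Matching Z τ → perm τ zero ≡ t
  forced-by-column {t} none τ m with perm-surjective τ t
  ... | zero  , e = e
  ... | suc i , e = ⊥-elim (none i (subst (T ∘ Z (suc i)) e (m (suc i))))

uniqueMatching-cong : ∀ {Z Z′ : Fin n → Fin n → Bool} {ρ} → (∀ i j → Z i j ≡ Z′ i j) →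
                      UniqueMatching Z ρ → UniqueMatching Z′ ρ
uniqueMatching-cong {Z = Z} {Z′} e (m , unique) =
  (λ i → subst T (e i _) (m i)) , λ τ mτ → unique τ (λ i → subst T (sym (e i _)) (mτ i))

uniqueMatching-swap : ∀ {Z : Fin (suc (suc n)) → Fin (suc (suc n)) → Bool} {ρ} →
                      UniqueMatching Z ρ → UniqueMatching (Z ∘ transpose₀₁) (swap ρ)
uniqueMatching-swap {Z = Z} {ρ} (m , unique) = m ∘ transpose₀₁ , agrees
  where
  agrees : ∀ τ → Matching (Z ∘ transpose₀₁) τ → swap ρ ≈ₚ τ
  agrees τ mτ i = trans (unique (swap τ) m′ (transpose₀₁ i)) (cong (perm τ) (transpose₀₁-involutive i))
    where
    m′ : Matching Z (swap τ)
    m′ j = subst (λ a → T (Z a (perm τ (transpose₀₁ j)))) (transpose₀₁-involutive j) (mτ (transpose₀₁ j))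

-- Zero patterns with prescribed signs of the maximal minors

-- Column k gets the sign κ k: the minor of Z without column k has a unique perfect
-- matching ρ, and insert k ρ, which matches a new first row to column k, has parity κ k.
Realizes : ∀ {d} → (Fin d → Fin (suc d) → Bool) → (Fin (suc d) → Bool) → Set
Realizes Z κ = ∀ k → ∃ λ ρ → UniqueMatching (deleteColumn Z k) ρ × parity (insert k ρ) ≡ κ k

Realizable : ∀ d → (Fin (suc d) → Bool) → Set
Realizable d κ = ∃ λ (Z : Fin d → Fin (suc d) → Bool) → Realizes Z κ

realizable-cong : ∀ {d} {κ κ′ : Fin (suc d) → Bool} → κ ≗ κ′ → Realizable d κ → Realizable d κ′
realizable-cong e (Z , r) = Z , λ k → let ρ , u , p = r k in ρ , u , trans p (e k)

realizable-empty : Realizable 0 (λ _ → true)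
realizable-empty = (λ ()) , λ { zero → id₀ , ((λ ()) , λ _ _ ()) , refl }

-- Reading each row as the edge between its two zero columns, attach₀ adds column 0 as a
-- leaf at column t and attach₁ adds column 1 as a leaf at column 0.
attach₀ : ∀ {d} → (Fin d → Fin (suc d) → Bool) → Fin (suc d) → Fin (suc d) → Fin (suc (suc d)) → Bool
attach₀ Z t = (true ∷ λ j → ⌊ j Fin.≟ t ⌋) ∷ λ i → false ∷ Z i

attach₁ : ∀ {d} → (Fin d → Fin (suc d) → Bool) → Fin (suc d) → Fin (suc (suc d)) → Bool
attach₁ Z = (true ∷ true ∷ λ _ → false) ∷ λ i → Z i zero ∷ false ∷ Z i ∘ suc

module _ {d} {Z : Fin d → Fin (suc d) → Bool} {κ : Fin (suc d) → Bool} (r : Realizes Z κ) where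

  realizes-attach₀ : ∀ t → Realizes (attach₀ Z t) (κ t ∷ not ∘ κ)
  realizes-attach₀ t zero with r t
  ... | ρ , u , p =
    insert t ρ ,
    uniqueMatching-insert {Z = deleteColumn (attach₀ Z t) zero} {t} {ρ} (fromWitness {a? = t Fin.≟ t} refl)
      (forced-by-row {Z = deleteColumn (attach₀ Z t) zero} λ j → toWitness {a? = j Fin.≟ t}) u ,
    trans (parity-insert-zero (insert t ρ)) p
  realizes-attach₀ t (suc k) with r k
  ... | ρ , u , p =
    insert zero ρ ,
    uniqueMatching-insert {Z = deleteColumn (attach₀ Z t) (suc k)} {zero} {ρ} _
      (forced-by-column {Z = deleteColumn (attach₀ Z t) (suc k)} λ i ()) u ,
    trans (parity-insert-suc-insert-zero k ρ) (cong not p)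

realizes-attach₁ : ∀ {d} {Z : Fin d → Fin (suc d) → Bool} {κ} →
                   Realizes Z κ → Realizes (attach₁ Z) (κ zero ∷ not (κ zero) ∷ κ ∘ suc)
realizes-attach₁ {Z = Z} r zero with r zero
... | ρ , u , p =
  insert zero ρ ,
  uniqueMatching-insert {Z = deleteColumn (attach₁ Z) zero} {zero} {ρ} _
    (forced-by-row {Z = deleteColumn (attach₁ Z) zero} λ { zero _ → refl ; (suc j) () }) u ,
  trans (parity-insert-zero (insert zero ρ)) p
realizes-attach₁ {Z = Z} r (suc zero) with r zero
... | ρ , u , p =
  insert zero ρ ,
  uniqueMatching-insert {Z = deleteColumn (attach₁ Z) (suc zero)} {zero} {ρ} _
    (forced-by-row {Z = deleteColumn (attach₁ Z) (suc zero)} λ { zero _ → refl ; (suc j) () }) u ,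
  trans (parity-insert-suc-insert-zero zero ρ) (cong not p)
realizes-attach₁ {suc d} {Z} r (suc (suc k)) with r (suc k)
... | ρ , u , p =
  insert (suc zero) ρ ,
  uniqueMatching-insert {Z = deleteColumn (attach₁ Z) (suc (suc k))} {suc zero} {ρ} _
    (forced-by-column {Z = deleteColumn (attach₁ Z) (suc (suc k))} λ i ())
    (uniqueMatching-cong {Z = deleteColumn Z (suc k)} {minor (deleteColumn (attach₁ Z) (suc (suc k))) (suc zero)} {ρ}
       (λ { i zero → refl ; i (suc j) → refl }) u) ,
  trans (parity-insert-suc-suc-insert-one k ρ) p

realizes-swap : ∀ {d} {Z : Fin (suc (suc d)) → Fin (suc (suc (suc d))) → Bool} {κ} →
                Realizes Z κ → Realizes (Z ∘ transpose₀₁) (not ∘ κ)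
realizes-swap {Z = Z} r k with r k
... | ρ , u , p =
  swap ρ , uniqueMatching-swap {Z = deleteColumn Z k} {ρ} u , trans (parity-insert-swap k ρ) (cong not p)

realizable-attach₀ : ∀ {d κ} → Realizable d κ → ∀ t → Realizable (suc d) (κ t ∷ not ∘ κ)
realizable-attach₀ (Z , r) t = attach₀ Z t , realizes-attach₀ {Z = Z} r t

realizable-attach₁ : ∀ {d κ} → Realizable d κ → Realizable (suc d) (κ zero ∷ not (κ zero) ∷ κ ∘ suc)
realizable-attach₁ (Z , r) = attach₁ Z , realizes-attach₁ {Z = Z} r

realizable-swap : ∀ {d κ} → Realizable (suc (suc d)) κ → Realizable (suc (suc d)) (not ∘ κ)
realizable-swap (Z , r) = Z ∘ transpose₀₁ , realizes-swap {Z = Z} r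

realizable-star : ∀ n → Realizable (suc n) (true ∷ λ _ → false)
realizable-star zero = realizable-cong (λ { zero → refl ; (suc zero) → refl })
  (realizable-attach₀ realizable-empty zero)
realizable-star (suc n) = realizable-cong (λ { zero → refl ; (suc zero) → refl ; (suc (suc k)) → refl })
  (realizable-attach₁ (realizable-star n))

NonConstant : ∀ {A : Set} → (Fin n → A) → Set
NonConstant κ = ∃ λ i → ∃ λ j → κ i ≢ κ j

nonConstant-head : {κ : Fin (suc n) → Bool} → NonConstant κ → ∃ λ t → κ (suc t) ≢ κ zero
nonConstant-head (zero  , zero  , ne) = contradiction refl ne
nonConstant-head (zero  , suc j , ne) = j , ne ∘ sym
nonConstant-head {κ = κ} (suc i , j , ne) with κ (suc i) Bool.≟ κ zero
... | no ne₀ = i , ne₀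
nonConstant-head (suc i , zero  , ne) | yes e = contradiction e ne
nonConstant-head (suc i , suc j , ne) | yes e = j , λ e′ → ne (trans e (sym e′))

-- Every non-constant sign pattern is realized up to a global sign: peel off
-- column 0 as a leaf when some other column has its sign, and otherwise
-- the pattern is that of a star centred at column 0.
realizable-up-to-sign : ∀ n (κ : Fin (suc n) → Bool) → NonConstant κ →
                        Realizable n κ ⊎ Realizable n (not ∘ κ)
realizable-up-to-sign zero κ (zero , zero , ne) = contradiction refl ne
realizable-up-to-sign (suc n) κ nc with any? (λ i → κ (suc i) Bool.≟ κ zero)
... | yes (i , e) = leaf (realizable-up-to-sign n (κ ∘ suc) (i , t , λ e′ → differs (trans (sym e′) e)))
  where
  t = proj₁ (nonConstant-head nc)
  differs = proj₂ (nonConstant-head nc)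
  flipped : κ (suc t) ≡ not (κ zero)
  flipped = ¬-not differs
  leaf : Realizable n (κ ∘ suc) ⊎ Realizable n (not ∘ κ ∘ suc) →
         Realizable (suc n) κ ⊎ Realizable (suc n) (not ∘ κ)
  leaf (inj₁ R) = inj₂ (realizable-cong (λ { zero → flipped ; (suc k) → refl }) (realizable-attach₀ R t))
  leaf (inj₂ R) = inj₁ (realizable-cong
    (λ { zero → trans (cong not flipped) (not-involutive (κ zero)) ; (suc k) → not-involutive (κ (suc k)) })
    (realizable-attach₀ R t))
... | no differ = star (κ zero) λ { zero → refl ; (suc i) → ¬-not (λ e → differ (i , e)) }
  where
  star : ∀ b → κ ≗ (b ∷ λ _ → not b) → Realizable (suc n) κ ⊎ Realizable (suc n) (not ∘ κ)
  star true  e = inj₁ (realizable-cong (sym ∘ e) (realizable-star n))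
  star false e = inj₂ (realizable-cong (λ { zero → cong not (sym (e zero)) ; (suc i) → cong not (sym (e (suc i))) })
    (realizable-star n))

realizable : ∀ m (κ : Fin (suc (suc (suc m))) → Bool) → NonConstant κ → Realizable (suc (suc m)) κ
realizable m κ nc with realizable-up-to-sign (suc (suc m)) κ nc
... | inj₁ R = R
... | inj₂ R = realizable-cong (not-involutive ∘ κ) (realizable-swap R)

∈⇔lookup : ∀ {K : Subset n} {k} → k ∈ K ⇔ Vec.lookup K k ≡ true
∈⇔lookup {K = K} {k} = mk⇔ []=⇒lookup (lookup⇒[]= k K)

x∉p⇒∣p∣≤n : ∀ {K : Subset (suc n)} {k} → k ∉ K → ∣ K ∣ ≤ n
x∉p⇒∣p∣≤n {n} {K} {k} k∉K = ℕ.≤-pred (subst (∣ K ∣ ℕ.<_) (∣⊤∣≡n (suc n)) (p⊂q⇒∣p∣<∣q∣ (⊆⊤ , k , ∈⊤ , k∉K)))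

1≤∣p∣⇒Nonempty : ∀ {K : Subset n} → 1 ≤ ∣ K ∣ → ∃ (_∈ K)
1≤∣p∣⇒Nonempty {n} {K} 1≤∣K∣ with nonempty? K
... | yes nonempty = nonempty
... | no empty = contradiction (subst (1 ≤_) (trans (cong ∣_∣ (Empty-unique empty)) (∣⊥∣≡0 n)) 1≤∣K∣) λ ()

∣p∣≤n⇒∃∉ : ∀ {K : Subset (suc n)} → ∣ K ∣ ≤ n → ∃ (_∉ K)
∣p∣≤n⇒∃∉ {n} {K} ∣K∣≤n with all? (_∈? K)
... | yes full = contradiction
  (ℕ.≤-trans (subst (_≤ ∣ K ∣) (∣⊤∣≡n (suc n)) (p⊆q⇒∣p∣≤∣q∣ {p = ⊤} {K} λ {x} _ → full x)) ∣K∣≤n) ℕ.1+n≰n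
... | no ¬full = ¬∀⟶∃¬ _ _ (_∈? K) ¬full

lookup-nonConstant : ∀ {K : Subset (suc n)} → 1 ≤ ∣ K ∣ → ∣ K ∣ ≤ n → NonConstant (Vec.lookup K)
lookup-nonConstant {K = K} 1≤∣K∣ ∣K∣≤n with 1≤∣p∣⇒Nonempty {K = K} 1≤∣K∣ | ∣p∣≤n⇒∃∉ {K = K} ∣K∣≤n
... | k , k∈K | j , j∉K = k , j , λ e →
  j∉K (Equivalence.from (∈⇔lookup {K = K}) (trans (sym e) (Equivalence.to (∈⇔lookup {K = K}) k∈K)))

-- Tropical determinants over the reals

module TropicalSign (R : Reals) where
  open Reals R renaming (_≤_ to _≤ᵣ_)
  open Tropical R
  open IsCommutativeRing isCommutativeRing
    using (+-comm; +-identityˡ; +-identityʳ; +-isCommutativeMonoid; +-isAbelianGroup)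
  open IsStrictTotalOrder <-isStrictTotalOrder
    using (compare; <-resp-≈; isStrictPartialOrder) renaming (trans to <-trans; irrefl to <-irrefl)
  open import Relation.Binary.Construct.StrictToNonStrict _≡_ _<_ as ≤ᵣ using ()

  +-commutativeMonoid : CommutativeMonoid _ _
  +-commutativeMonoid = record { isCommutativeMonoid = +-isCommutativeMonoid }

  +-abelianGroup : AbelianGroup _ _
  +-abelianGroup = record { isAbelianGroup = +-isAbelianGroup }

  <-strictPartialOrder : StrictPartialOrder _ _ _
  <-strictPartialOrder = record { isStrictPartialOrder = isStrictPartialOrder }

  open import Algebra.Properties.AbelianGroup +-abelianGroup
    using (\\-leftDividesʳ; xyx⁻¹≈y; ⁻¹-involutive)
  open import Algebra.Properties.CommutativeSemigroup (CommutativeMonoid.commutativeSemigroup +-commutativeMonoid)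
    using (x∙yz≈y∙xz)
  module ∑ = Algebra.Properties.CommutativeMonoid.Sum +-commutativeMonoid
  open import Relation.Binary.Reasoning.StrictPartialOrder <-strictPartialOrder

  ≤ᵣ-refl : ∀ {x} → x ≤ᵣ x
  ≤ᵣ-refl = inj₂ refl

  ≤ᵣ-trans : ∀ {x y z} → x ≤ᵣ y → y ≤ᵣ z → x ≤ᵣ z
  ≤ᵣ-trans = ≤ᵣ.trans isEquivalence <-resp-≈ <-trans

  ≤ᵣ-antisym : ∀ {x y} → x ≤ᵣ y → y ≤ᵣ x → x ≡ y
  ≤ᵣ-antisym = ≤ᵣ.antisym isEquivalence <-trans <-irrefl

  ≤ᵣ⊎> : ∀ x y → x ≤ᵣ y ⊎ y < x
  ≤ᵣ⊎> x y with compare x y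
  ... | tri< x<y _ _ = inj₁ (inj₁ x<y)
  ... | tri≈ _ x≡y _ = inj₁ (inj₂ x≡y)
  ... | tri> _ _ y<x = inj₂ y<x

  +-monoʳ-< : ∀ z {x y} → x < y → z + x < z + y
  +-monoʳ-< z {x} {y} x<y = subst₂ _<_ (+-comm x z) (+-comm y z) (+-mono-< z x<y)

  +-monoʳ-≤ : ∀ z {x y} → x ≤ᵣ y → z + x ≤ᵣ z + y
  +-monoʳ-≤ z = Sum.map (+-monoʳ-< z) (cong (z +_))

  +-monoˡ-≤ : ∀ z {x y} → x ≤ᵣ y → x + z ≤ᵣ y + z
  +-monoˡ-≤ z = Sum.map (+-mono-< z) (cong (_+ z))

  +-mono-≤ : ∀ {x y u v} → x ≤ᵣ y → u ≤ᵣ v → x + u ≤ᵣ y + v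
  +-mono-≤ {y = y} {u} x≤y u≤v = ≤ᵣ-trans (+-monoˡ-≤ u x≤y) (+-monoʳ-≤ y u≤v)

  +-cancelˡ-< : ∀ z {x y} → z + x < z + y → x < y
  +-cancelˡ-< z {x} {y} lt = subst₂ _<_ (\\-leftDividesʳ z x) (\\-leftDividesʳ z y) (+-monoʳ-< (- z) lt)

  +-cancelˡ-≤ : ∀ z {x y} → z + x ≤ᵣ z + y → x ≤ᵣ y
  +-cancelˡ-≤ z {x} {y} = Sum.map (+-cancelˡ-< z) λ e →
    trans (sym (\\-leftDividesʳ z x)) (trans (cong (- z +_) e) (\\-leftDividesʳ z y))

  +-cancelʳ-≤ : ∀ z {x y} → x + z ≤ᵣ y + z → x ≤ᵣ y
  +-cancelʳ-≤ z {x} {y} = +-cancelˡ-≤ z ∘ subst₂ _≤ᵣ_ (+-comm x z) (+-comm y z)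

  sumFin-cong : ∀ {f g : Fin n → ℝ} → f ≗ g → sumFin n f ≡ sumFin n g
  sumFin-cong {zero}  e = refl
  sumFin-cong {suc n} e = cong₂ _+_ (e zero) (sumFin-cong (e ∘ suc))

  sumFin≡∑ : (f : Fin n → ℝ) → sumFin n f ≡ ∑.sum f
  sumFin≡∑ {zero}  f = refl
  sumFin≡∑ {suc n} f = cong (f zero +_) (sumFin≡∑ (f ∘ suc))

  sumFin-∘perm : (σ : Perm n) (g : Fin n → ℝ) → sumFin n (g ∘ perm σ) ≡ sumFin n g
  sumFin-∘perm σ g = trans (sumFin≡∑ (g ∘ perm σ))
    (trans (sum-∘perm +-commutativeMonoid σ g) (sym (sumFin≡∑ g)))

  sumFin-distrib-+ : (f g : Fin n → ℝ) → sumFin n (λ i → f i + g i) ≡ sumFin n f + sumFin n g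
  sumFin-distrib-+ f g = trans (sumFin≡∑ (λ i → f i + g i))
    (trans (∑.∑-distrib-+ f g) (sym (cong₂ _+_ (sumFin≡∑ f) (sumFin≡∑ g))))

  sumFin-remove : (g : Fin (suc n) → ℝ) (k : Fin (suc n)) → sumFin (suc n) g ≡ g k + sumFin n (removeAt g k)
  sumFin-remove g k = trans (sumFin≡∑ g) (trans (∑.sum-remove {i = k} g) (cong (g k +_) (sym (sumFin≡∑ (removeAt g k)))))

  sumFin-zero : sumFin n (λ _ → 0#) ≡ 0#
  sumFin-zero {n} = trans (sumFin≡∑ {n} (λ _ → 0#)) (∑.sum-replicate-zero n)

  sumFin-nonnegative : (f : Fin n → ℝ) → (∀ i → 0# ≤ᵣ f i) → 0# ≤ᵣ sumFin n f
  sumFin-nonnegative {zero}  f f≥0 = ≤ᵣ-refl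
  sumFin-nonnegative {suc n} f f≥0 = subst (_≤ᵣ sumFin (suc n) f) (+-identityˡ 0#)
    (+-mono-≤ (f≥0 zero) (sumFin-nonnegative (f ∘ suc) (f≥0 ∘ suc)))

  term-≤-sumFin : (f : Fin n → ℝ) → (∀ i → 0# ≤ᵣ f i) → ∀ i → f i ≤ᵣ sumFin n f
  term-≤-sumFin {suc n} f f≥0 i = subst₂ _≤ᵣ_ (+-identityʳ (f i)) (sym (sumFin-remove f i))
    (+-monoʳ-≤ (f i) (sumFin-nonnegative (removeAt f i) (f≥0 ∘ punchIn i)))

  weight-cong : (M : Matrix n) {σ τ : Perm n} → σ ≈ₚ τ → weight M σ ≡ weight M τ
  weight-cong M e = sumFin-cong (λ i → cong (M i) (e i))

  weight-remove : (M : Matrix (suc n)) (σ : Perm (suc n)) →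
                  weight M σ ≡ M zero (perm σ zero) + weight (minor M (perm σ zero)) (remove σ)
  weight-remove M σ = weight-cong M {σ} {insert (perm σ zero) (remove σ)} (λ i → sym (insert-remove σ i))

  UniqueMinimizer : Matrix n → Perm n → Set
  UniqueMinimizer M σ = Minimizer M σ × (∀ τ → Minimizer M τ → ¬ DistinctPerm σ τ)

  uniqueMinimizer-≈ₚ : ∀ (M : Matrix n) {σ τ} → UniqueMinimizer M σ → Minimizer M τ → σ ≈ₚ τ
  uniqueMinimizer-≈ₚ M {σ} {τ} (_ , unique) mτ =
    decidable-stable (all? λ i → perm σ i Fin.≟ perm τ i) (unique τ mτ)

  minimizer-weight : ∀ (M : Matrix n) {σ τ} → Minimizer M σ → Minimizer M τ → weight M σ ≡ weight M τ
  minimizer-weight M {σ} {τ} mσ mτ = ≤ᵣ-antisym (mσ τ) (mτ σ)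

  argmin : (v : Fin (suc n) → ℝ) → ∃ λ t → ∀ j → v t ≤ᵣ v j
  argmin {zero}  v = zero , λ { zero → ≤ᵣ-refl }
  argmin {suc n} v with argmin (v ∘ suc)
  ... | t , min with ≤ᵣ⊎> (v zero) (v (suc t))
  ...   | inj₁ le = zero  , λ { zero → ≤ᵣ-refl ; (suc j) → ≤ᵣ-trans le (min j) }
  ...   | inj₂ gt = suc t , λ { zero → inj₁ gt ; (suc j) → min j }

  minimizer-exists : (M : Matrix n) → ∃ (Minimizer M)
  minimizer-exists {zero}  M = id₀ , λ _ → ≤ᵣ-refl
  minimizer-exists {suc n} M = insert t (μ t) , λ τ → begin
    v t                                                     ≤⟨ min (perm τ zero) ⟩
    v (perm τ zero)                                         ≤⟨ +-monoʳ-≤ _ (proj₂ (minimizer-exists (minor M (perm τ zero))) (remove τ)) ⟩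
    M zero (perm τ zero) + weight (minor M (perm τ zero)) (remove τ) ≡⟨ weight-remove M τ ⟨
    weight M τ                                              ∎
    where
    μ : ∀ j → Perm n
    μ j = proj₁ (minimizer-exists (minor M j))
    v : Fin (suc n) → ℝ
    v j = M zero j + weight (minor M j) (μ j)
    t = proj₁ (argmin v)
    min = proj₂ (argmin v)

  tdet : Matrix n → ℝ
  tdet M = weight M (proj₁ (minimizer-exists M))

  tdet-≤ : (M : Matrix n) → ∀ τ → tdet M ≤ᵣ weight M τ
  tdet-≤ M = proj₂ (minimizer-exists M)

  minimizer-tdet : ∀ (M : Matrix n) {σ} → Minimizer M σ → weight M σ ≡ tdet M
  minimizer-tdet M {σ} mσ = minimizer-weight M {σ} {proj₁ (minimizer-exists M)} mσ (tdet-≤ M)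

  expansionTerm : Matrix (suc n) → Fin (suc n) → ℝ
  expansionTerm M j = M zero j + tdet (minor M j)

  expansionTerm-≤-weight : (M : Matrix (suc n)) → ∀ τ → expansionTerm M (perm τ zero) ≤ᵣ weight M τ
  expansionTerm-≤-weight M τ = subst (expansionTerm M (perm τ zero) ≤ᵣ_) (sym (weight-remove M τ))
    (+-monoʳ-≤ (M zero (perm τ zero)) (tdet-≤ (minor M (perm τ zero)) (remove τ)))

  remove-minimizer : ∀ (M : Matrix (suc n)) {σ} → Minimizer M σ → Minimizer (minor M (perm σ zero)) (remove σ)
  remove-minimizer M {σ} mσ ρ = +-cancelˡ-≤ (M zero (perm σ zero))
    (subst (_≤ᵣ weight M (insert (perm σ zero) ρ)) (weight-remove M σ) (mσ (insert (perm σ zero) ρ)))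

  remove-uniqueMinimizer : ∀ (M : Matrix (suc n)) {σ} →
                           UniqueMinimizer M σ → UniqueMinimizer (minor M (perm σ zero)) (remove σ)
  remove-uniqueMinimizer M {σ} (mσ , unique) = remove-minimizer M {σ} mσ , λ ρ mρ distinct →
    unique (insert k ρ) (minimizer-insert ρ mρ) (distinct ∘ remove-≈ₚ {σ = σ} {k} {ρ})
    where
    k = perm σ zero
    minimizer-insert : ∀ ρ → Minimizer (minor M k) ρ → Minimizer M (insert k ρ)
    minimizer-insert ρ mρ τ = ≤ᵣ-trans (subst (M zero k + weight (minor M k) ρ ≤ᵣ_) (sym (weight-remove M σ))
      (+-monoʳ-≤ (M zero k) (mρ (remove σ)))) (mσ τ)

  -- If another term of the expansion were as small, inserting that column
  -- would produce a second minimizer.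
  uniqueMinimizer-strict : ∀ (M : Matrix (suc n)) {σ} → UniqueMinimizer M σ →
    ∀ j → j ≢ perm σ zero → expansionTerm M (perm σ zero) < expansionTerm M j
  uniqueMinimizer-strict M {σ} (mσ , unique) j j≢k
    with ≤ᵣ⊎> (expansionTerm M j) (expansionTerm M (perm σ zero))
  ... | inj₂ lt = lt
  ... | inj₁ le = ⊥-elim (unique (insert j μ) minimizer (λ e → j≢k (sym (e zero))))
    where
    μ = proj₁ (minimizer-exists (minor M j))
    minimizer : Minimizer M (insert j μ)
    minimizer τ = ≤ᵣ-trans le (≤ᵣ-trans (expansionTerm-≤-weight M σ) (mσ τ))

  strict-uniqueMinimizer : ∀ (M : Matrix (suc n)) {t ρ} →
    (∀ j → j ≢ t → expansionTerm M t < expansionTerm M j) →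
    UniqueMinimizer (minor M t) ρ → UniqueMinimizer M (insert t ρ)
  strict-uniqueMinimizer M {t} {ρ} below uρ@(mρ , _) = minimizer , unique
    where
    weight≡ : weight M (insert t ρ) ≡ expansionTerm M t
    weight≡ = cong (M zero t +_) (minimizer-tdet (minor M t) {ρ} mρ)
    smallest : ∀ j → expansionTerm M t ≤ᵣ expansionTerm M j
    smallest j with j Fin.≟ t
    ... | yes refl = ≤ᵣ-refl
    ... | no j≢t   = inj₁ (below j j≢t)
    minimizer : Minimizer M (insert t ρ)
    minimizer τ = begin
      weight M (insert t ρ)           ≡⟨ weight≡ ⟩
      expansionTerm M t               ≤⟨ smallest (perm τ zero) ⟩
      expansionTerm M (perm τ zero)   ≤⟨ expansionTerm-≤-weight M τ ⟩
      weight M τ                      ∎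
    unique : ∀ τ → Minimizer M τ → ¬ DistinctPerm (insert t ρ) τ
    unique τ mτ distinct with perm τ zero Fin.≟ t
    ... | yes τ₀≡t = distinct (insert-≈ₚ {τ = τ} {t} {ρ} τ₀≡t
      (uniqueMinimizer-≈ₚ (minor M t) {ρ} {remove τ} uρ
        (subst (λ k → Minimizer (minor M k) (remove τ)) τ₀≡t (remove-minimizer M {τ} mτ))))
    ... | no τ₀≢t = <-irrefl refl (begin-strict
      expansionTerm M t               <⟨ below (perm τ zero) τ₀≢t ⟩
      expansionTerm M (perm τ zero)   ≤⟨ expansionTerm-≤-weight M τ ⟩
      weight M τ                      ≤⟨ mτ (insert t ρ) ⟩
      weight M (insert t ρ)           ≡⟨ weight≡ ⟩
      expansionTerm M t               ∎)

  uniqueMinimizer? : (M : Matrix n) → Dec (∃ (UniqueMinimizer M))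
  uniqueMinimizer? M = decide (any-perm? {P = Rival} (λ {σ} {τ} → rival-resp {σ} {τ}) rival?)
    where
    σ₀ = proj₁ (minimizer-exists M)
    Rival : Perm _ → Set
    Rival τ = weight M τ ≤ᵣ tdet M × DistinctPerm σ₀ τ
    rival-resp : ∀ {σ τ} → σ ≈ₚ τ → Rival σ → Rival τ
    rival-resp {σ} {τ} e (σ≤ , distinct) = subst (_≤ᵣ tdet M) (weight-cong M {σ} {τ} e) σ≤ ,
                                   λ e′ → distinct λ i → trans (e′ i) (sym (e i))
    rival? : ∀ τ → Dec (Rival τ)
    rival? τ = ≤ᵣ.decidable′ compare (weight M τ) (tdet M) ×-dec ¬? (all? λ i → perm σ₀ i Fin.≟ perm τ i)
    decide : Dec (∃ Rival) → Dec (∃ (UniqueMinimizer M))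
    decide (yes (τ , τ≤ , distinct)) = no λ (σ , uσ) → distinct λ i →
      trans (sym (uniqueMinimizer-≈ₚ M {σ} {σ₀} uσ (tdet-≤ M) i))
            (uniqueMinimizer-≈ₚ M {σ} {τ} uσ (λ τ′ → ≤ᵣ-trans τ≤ (tdet-≤ M τ′)) i)
    decide (no none) = yes (σ₀ , tdet-≤ M , λ τ mτ distinct → none (τ , mτ σ₀ , distinct))

  sgn≡plus⇒parity : (σ : Perm n) → sgn σ ≡ plus → parity σ ≡ true
  sgn≡plus⇒parity σ = lemma (parity σ)
    where
    lemma : ∀ b → (if b then plus else minus) ≡ plus → b ≡ true
    lemma true  _ = refl
    lemma false ()

  hasTSgn-plus⇔ : (M : Matrix n) → HasTSgn M plus ⇔ (∃ λ σ → UniqueMinimizer M σ × parity σ ≡ true)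
  hasTSgn-plus⇔ M = mk⇔ (to ∘ regular-view) λ (σ , (mσ , uσ) , par) →
    subst (HasTSgn M) (cong (if_then plus else minus) par) (regular σ mσ uσ)
    where
    regular-view : ∀ {s} → HasTSgn M s → s ≡ zero ⊎ ∃ λ σ → UniqueMinimizer M σ × sgn σ ≡ s
    regular-view (singular _)        = inj₁ refl
    regular-view (regular σ mσ uσ) = inj₂ (σ , (mσ , uσ) , refl)
    to : plus ≡ zero ⊎ (∃ λ σ → UniqueMinimizer M σ × sgn σ ≡ plus) →
         ∃ λ σ → UniqueMinimizer M σ × parity σ ≡ true
    to (inj₂ (σ , uσ , s)) = σ , uσ , sgn≡plus⇒parity σ s

  -- The sign of tsgn(x, p₁, …, p_d) through the maximal minors of the p's

  Positive : ∀ {d} → (Fin d → Point d) → Fin (suc d) → Set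
  Positive p k = ∃ λ ρ → UniqueMinimizer (deleteColumn p k) ρ × parity (insert k ρ) ≡ true

  positive? : ∀ {d} (p : Fin d → Point d) k → Dec (Positive p k)
  positive? p k with uniqueMinimizer? (deleteColumn p k)
  ... | no none = no λ (ρ , uρ , _) → none (ρ , uρ)
  ... | yes (ρ , uρ) with parity (insert k ρ) Bool.≟ true
  ...   | yes par = yes (ρ , uρ , par)
  ...   | no ¬par = no λ (ρ′ , uρ′ , par′) → ¬par
          (trans (parity-cong {σ = insert k ρ} {insert k ρ′}
            (insert-cong k {ρ} {ρ′} (uniqueMinimizer-≈ₚ (deleteColumn p k) {ρ} {ρ′} uρ (proj₁ uρ′)))) par′)

  tauOne⇔positiveMinor : ∀ {d} (p : Fin d → Point d) x → TauOne p x ⇔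
            ∃ λ k → Positive p k × (∀ j → j ≢ k → x k + tdet (deleteColumn p k) < x j + tdet (deleteColumn p j))
  tauOne⇔positiveMinor p x = mk⇔ (to ∘ Equivalence.to (hasTSgn-plus⇔ N)) (Equivalence.from (hasTSgn-plus⇔ N) ∘ from)
    where
    N = rowsMatrix x p
    to : (∃ λ σ → UniqueMinimizer N σ × parity σ ≡ true) → _
    to (σ , uσ , par) = perm σ zero ,
      (remove σ , remove-uniqueMinimizer N {σ} uσ , trans (parity-cong {σ = insert (perm σ zero) (remove σ)} {σ} (insert-remove σ)) par) ,
      uniqueMinimizer-strict N {σ} uσ
    from : (∃ λ k → Positive p k × (∀ j → j ≢ k → expansionTerm N k < expansionTerm N j)) →
           ∃ λ σ → UniqueMinimizer N σ × parity σ ≡ true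
    from (k , (ρ , uρ , par) , below) = insert k ρ , strict-uniqueMinimizer N {k} {ρ} below uρ , par

  -- Two equal rows make the weight invariant under swapping them, and
  -- swapping changes the parity of every minimizer.
  not-all-positive : ∀ {d} (p : Fin (suc d) → Point (suc d)) → ¬ (∀ k → Positive p k)
  not-all-positive p positive = contradiction
    (trans (sym (minimizer-positive (swap σ) swap-minimizer))
           (trans (parity-swap σ) (cong not (minimizer-positive σ mσ))))
    λ ()
    where
    N = rowsMatrix (p zero) p
    σ = proj₁ (minimizer-exists N)
    mσ = proj₂ (minimizer-exists N)
    swap-minimizer : Minimizer N (swap σ)
    swap-minimizer τ = subst (_≤ᵣ weight N τ) (x∙yz≈y∙xz (p zero (perm σ zero)) (p zero (perm σ (suc zero))) _) (mσ τ)
    minimizer-positive : ∀ τ → Minimizer N τ → parity τ ≡ true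
    minimizer-positive τ mτ = let ρ , uρ , par = positive (perm τ zero) in
      trans (parity-cong {σ = τ} {insert (perm τ zero) (remove τ)} (λ i → sym (insert-remove τ i)))
            (trans (parity-cong {σ = insert (perm τ zero) (remove τ)} {insert (perm τ zero) ρ} (insert-cong (perm τ zero) {remove τ} {ρ}
              (λ i → sym (uniqueMinimizer-≈ₚ (deleteColumn p (perm τ zero)) {ρ} {remove τ} uρ (remove-minimizer N {τ} mτ) i))))
              par)

  inSector⇔ : ∀ {d} (T : ℝ) {c w : Point d} → (∀ j → w j ≡ T + - c j) →
              ∀ k x → InSector c k x ⇔ (∀ j → j ≢ k → x k + w k < x j + w j)
  inSector⇔ T {c} {w} w≡ k x = mk⇔
    (λ s j j≢k → subst₂ _<_ (sym (shift k)) (sym (shift j)) (+-monoʳ-< T (s j j≢k)))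
    (λ s j j≢k → +-cancelˡ-< T (subst₂ _<_ (shift k) (shift j) (s j j≢k)))
    where
    shift : ∀ j → x j + w j ≡ T + (x j -ℝ c j)
    shift j = trans (cong (x j +_) (w≡ j)) (x∙yz≈y∙xz (x j) T (- c j))

  tauOne⇔inUnion : ∀ {d} (p : Fin d → Point d) (c : Point d) (K : Subset (suc d)) (T : ℝ) →
    (∀ k → Positive p k ⇔ k ∈ K) → (∀ j → tdet (deleteColumn p j) ≡ T + - c j) →
    ∀ x → TauOne p x ⇔ InUnion c K x
  tauOne⇔inUnion p c K T positive⇔ tdet≡ x = mk⇔
    (λ t → let k , pos , below = Equivalence.to (tauOne⇔positiveMinor p x) t in
      k , Equivalence.to (positive⇔ k) pos , Equivalence.from (inSector⇔ T tdet≡ k x) below)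
    (λ (k , k∈K , sector) → Equivalence.from (tauOne⇔positiveMinor p x)
      (k , Equivalence.from (positive⇔ k) k∈K , Equivalence.to (inSector⇔ T tdet≡ k x) sector))

  zeroOne : Bool → ℝ
  zeroOne true  = 0#
  zeroOne false = 1#

  zeroOnes : ∀ {m n} → (Fin m → Fin n → Bool) → Fin m → Fin n → ℝ
  zeroOnes Z i j = zeroOne (Z i j)

  zeroOne-nonnegative : ∀ b → 0# ≤ᵣ zeroOne b
  zeroOne-nonnegative true  = ≤ᵣ-refl
  zeroOne-nonnegative false = inj₁ 0<1

  weight-nonnegative : (Z : Fin n → Fin n → Bool) → ∀ τ → 0# ≤ᵣ weight (zeroOnes Z) τ
  weight-nonnegative Z τ = sumFin-nonnegative _ λ i → zeroOne-nonnegative (Z i (perm τ i))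

  weight-matching : (Z : Fin n → Fin n → Bool) → ∀ {τ} → Matching Z τ → weight (zeroOnes Z) τ ≡ 0#
  weight-matching {n} Z {τ} m = trans (sumFin-cong λ i → zero-entry (Z i (perm τ i)) (m i)) (sumFin-zero {n})
    where
    zero-entry : ∀ b → T b → zeroOne b ≡ 0#
    zero-entry true _ = refl

  weight-not-matching : (Z : Fin n → Fin n → Bool) → ∀ {τ} → ¬ Matching Z τ → 1# ≤ᵣ weight (zeroOnes Z) τ
  weight-not-matching {n} Z {τ} ¬m with ¬∀⟶∃¬ n _ (λ i → T? (Z i (perm τ i))) ¬m
  ... | i , ¬zero = subst (_≤ᵣ weight (zeroOnes Z) τ) (one-entry (Z i (perm τ i)) ¬zero)
    (term-≤-sumFin _ (λ i → zeroOne-nonnegative (Z i (perm τ i))) i)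
    where
    one-entry : ∀ b → ¬ T b → zeroOne b ≡ 1#
    one-entry true  ¬t = contradiction _ ¬t
    one-entry false _  = refl

  uniqueMatching⇒uniqueMinimizer : ∀ (Z : Fin n → Fin n → Bool) {ρ} → UniqueMatching Z ρ →
                                   UniqueMinimizer (zeroOnes Z) ρ × weight (zeroOnes Z) ρ ≡ 0#
  uniqueMatching⇒uniqueMinimizer Z {ρ} (m , unique) = (minimizer , only) , weight-matching Z {ρ} m
    where
    minimizer : Minimizer (zeroOnes Z) ρ
    minimizer τ = subst (_≤ᵣ weight (zeroOnes Z) τ) (sym (weight-matching Z {ρ} m)) (weight-nonnegative Z τ)
    only : ∀ τ → Minimizer (zeroOnes Z) τ → ¬ DistinctPerm ρ τ
    only τ mτ distinct with all? (λ i → T? (Z i (perm τ i)))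
    ... | yes mt = distinct (unique τ mt)
    ... | no ¬mt = <-irrefl refl (begin-strict
      0#                         <⟨ 0<1 ⟩
      1#                         ≤⟨ weight-not-matching Z {τ} ¬mt ⟩
      weight (zeroOnes Z) τ      ≤⟨ mτ ρ ⟩
      weight (zeroOnes Z) ρ      ≡⟨ weight-matching Z {ρ} m ⟩
      0#                         ∎)

  uniqueMinimizer-translate : ∀ (A B : Matrix n) (C : ℝ) → (∀ τ → weight B τ ≡ weight A τ + C) →
                              ∀ {ρ} → UniqueMinimizer A ρ → UniqueMinimizer B ρ
  uniqueMinimizer-translate A B C B≡ {ρ} (mρ , unique) =
    (λ τ → subst₂ _≤ᵣ_ (sym (B≡ ρ)) (sym (B≡ τ)) (+-monoˡ-≤ C (mρ τ))) ,
    (λ τ mτ → unique τ λ τ′ → +-cancelʳ-≤ C (subst₂ _≤ᵣ_ (B≡ τ) (B≡ τ′) (mτ τ′)))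

  tauOne-sectors : ∀ {d} (p : Fin (suc d) → Point (suc d)) →
                   ∃[ c ] ∃[ K ] (∣ K ∣ ≤ suc d × (∀ x → TauOne p x ⇔ InUnion c K x))
  tauOne-sectors {d} p = c , K , size , tauOne⇔inUnion p c K 0# positive⇔ tdet≡
    where
    c : Point (suc d)
    c j = - tdet (deleteColumn p j)
    positive : Fin (suc (suc d)) → Bool
    positive k = ⌊ positive? p k ⌋
    K : Subset (suc (suc d))
    K = Vec.tabulate positive
    positive⇔ : ∀ k → Positive p k ⇔ k ∈ K
    positive⇔ k = mk⇔
      (λ pos → Equivalence.from (∈⇔lookup {K = K})
        (trans (lookup∘tabulate positive k) (Equivalence.to T-≡ (fromWitness {a? = positive? p k} pos))))
      (λ k∈K → toWitness {a? = positive? p k}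
        (Equivalence.from T-≡ (trans (sym (lookup∘tabulate positive k)) (Equivalence.to (∈⇔lookup {K = K}) k∈K))))
    tdet≡ : ∀ j → tdet (deleteColumn p j) ≡ 0# + - c j
    tdet≡ j = sym (trans (+-identityˡ (- c j)) (⁻¹-involutive _))
    nonpositive : ∃ λ k → ¬ Positive p k
    nonpositive = ¬∀⟶∃¬ (suc (suc d)) (Positive p) (positive? p) (not-all-positive p)
    size : ∣ K ∣ ≤ suc d
    size = x∉p⇒∣p∣≤n {K = K} {proj₁ nonpositive} (proj₂ nonpositive ∘ Equivalence.from (positive⇔ (proj₁ nonpositive)))

  realizes⇒sectors : ∀ {d} (c : Point d) (K : Subset (suc d)) {Z : Fin d → Fin (suc d) → Bool} →
                     Realizes Z (Vec.lookup K) → ∃[ p ] (∀ x → TauOne p x ⇔ InUnion c K x)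
  realizes⇒sectors {d} c K {Z} realizes = p , tauOne⇔inUnion p c K ∑c positive⇔ tdet≡
    where
    p : Fin d → Point d
    p i j = zeroOnes Z i j + c j
    ∑c : ℝ
    ∑c = sumFin (suc d) c
    C : Fin (suc d) → ℝ
    C k = sumFin d (removeAt c k)
    ρ : Fin (suc d) → Perm d
    ρ k = proj₁ (realizes k)
    parity≡ : ∀ k → parity (insert k (ρ k)) ≡ Vec.lookup K k
    parity≡ k = proj₂ (proj₂ (realizes k))
    zero-one : ∀ k → UniqueMinimizer (zeroOnes (deleteColumn Z k)) (ρ k) ×
                     weight (zeroOnes (deleteColumn Z k)) (ρ k) ≡ 0#
    zero-one k = uniqueMatching⇒uniqueMinimizer (deleteColumn Z k) {ρ k} (proj₁ (proj₂ (realizes k)))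
    weight≡ : ∀ k τ → weight (deleteColumn p k) τ ≡ weight (zeroOnes (deleteColumn Z k)) τ + C k
    weight≡ k τ = trans (sumFin-distrib-+ (λ i → zeroOnes Z i (punchIn k (perm τ i))) (λ i → c (punchIn k (perm τ i))))
      (cong (weight (zeroOnes (deleteColumn Z k)) τ +_) (sumFin-∘perm τ (removeAt c k)))
    unique : ∀ k → UniqueMinimizer (deleteColumn p k) (ρ k)
    unique k = uniqueMinimizer-translate (zeroOnes (deleteColumn Z k)) (deleteColumn p k) (C k) (weight≡ k)
      {ρ k} (proj₁ (zero-one k))
    tdet≡ : ∀ j → tdet (deleteColumn p j) ≡ ∑c + - c j
    tdet≡ j = begin-equality
      tdet (deleteColumn p j)                             ≡⟨ minimizer-tdet (deleteColumn p j) {ρ j} (proj₁ (unique j)) ⟨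
      weight (deleteColumn p j) (ρ j)                     ≡⟨ weight≡ j (ρ j) ⟩
      weight (zeroOnes (deleteColumn Z j)) (ρ j) + C j    ≡⟨ cong (_+ C j) (proj₂ (zero-one j)) ⟩
      0# + C j                                            ≡⟨ +-identityˡ (C j) ⟩
      C j                                                 ≡⟨ xyx⁻¹≈y (c j) (C j) ⟨
      (c j + C j) + - c j                                 ≡⟨ cong (_+ - c j) (sumFin-remove c j) ⟨
      ∑c + - c j                                          ∎
    positive⇔ : ∀ k → Positive p k ⇔ k ∈ K
    positive⇔ k = mk⇔
      (λ (ρ′ , uρ′ , par′) → Equivalence.from (∈⇔lookup {K = K}) (trans (sym (parity≡ k))
        (trans (parity-cong {σ = insert k (ρ k)} {insert k ρ′}
          (insert-cong k {ρ k} {ρ′} (uniqueMinimizer-≈ₚ (deleteColumn p k) {ρ k} {ρ′} (unique k) (proj₁ uρ′)))) par′)))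
      (λ k∈K → ρ k , unique k , trans (parity≡ k) (Equivalence.to (∈⇔lookup {K = K}) k∈K))

theorem4p7 : (R : Reals) → let open Tropical R in
    (d : ℕ) → 2 ≤ d →
    ((p : Fin d → Point d) →
       (∀ x → ¬ TauOne p x)
       ⊎ (∃[ c ] ∃[ K ] (∣ K ∣ ≤ d × (∀ x → TauOne p x ⇔ InUnion c K x))))
    × ((c : Point d) → (K : Subset (suc d)) → 1 ≤ ∣ K ∣ → ∣ K ∣ ≤ d →
       ∃[ p ] (∀ x → TauOne p x ⇔ InUnion c K x))
theorem4p7 R (suc zero) (s≤s ())
theorem4p7 R (suc (suc m)) _ =
  (λ p → inj₂ (tauOne-sectors p)) ,
  (λ c K 1≤∣K∣ ∣K∣≤d → let Z , realizes = realizable m (Vec.lookup K) (lookup-nonConstant {K = K} 1≤∣K∣ ∣K∣≤d) in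
    realizes⇒sectors c K {Z} realizes)
  where open TropicalSign R
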